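{- Let $(Q,\sqsubseteq,\otimes,\mathbb{1})$ be a continuous quantale and let $d:X\times X\to Q$ be a $Q$-metric on a set $X$. Let $\mathsf{C}(Q)$ be the set of Scott closed subsets of $Q$, ordered by inclusion, with tensor $A_1\otimes_{\mathsf{C}}A_2=\overline{\{q_1\otimes q_2 : q_1\in A_1,\ q_2\in A_2\}}$ (closure in the Scott topology of $Q$) and unit ${\downarrow}\mathbb{1}=\{q: q\sqsubseteq\mathbb{1}\}$; this is a continuous quantale. Define $d_S:\mathsf{P}(X)\times\mathsf{P}(X)\to\mathsf{C}(Q)$ by $$d_S(A_1,A_2)=\bigcap_{x_2\in A_2}\overline{\{d(x_1,x_2): x_1\in A_1\}}$$ (closure in the Scott topology of $Q$); $d_S$ is a $\mathsf{C}(Q)$-metric on $\mathsf{P}(X)$. Then the robust topology $\tau_{d,R}$ on $\mathsf{P}(X)$ coincides with the open ball topology $\tau_{d_S}$ of $(\mathsf{P}(X),d_S,\mathsf{C}(Q))$.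
   Context: A quantale $(Q,\sqsubseteq,\otimes,\mathbb{1})$ is a complete lattice $(Q,\sqsubseteq)$ with a monoid structure $(Q,\otimes,\mathbb{1})$ such that $x\otimes\bigsqcup S=\bigsqcup\{x\otimes y:y\in S\}$ and $(\bigsqcup S)\otimes x=\bigsqcup\{y\otimes x: y\in S\}$ for all $x\in Q$, $S\subseteq Q$. In a complete lattice, $x\ll y$ (way-below) means: for every directed $D\subseteq Q$, $y\sqsubseteq\bigsqcup D$ implies $x\sqsubseteq d$ for some $d\in D$. A quantale is continuous if its lattice is continuous, i.e. $y=\bigsqcup\{x: x\ll y\}$ for all $y$. A $Q$-metric on a set $X$ is a map $d:X\times X\to Q$ with $d(x,y)\otimes d(y,z)\sqsubseteq d(x,z)$ and $\mathbb{1}\sqsubseteq d(x,x)$ for all $x,y,z$ (no symmetry or separation required). For a $Q$-metric $d$ with $Q$ continuous, the open ball with center $x$ and radius $\delta\ll\mathbb{1}$ is $B(x,\delta)=\{y\in X:\delta\ll d(x,y)\}$, and the open ball topology $\tau_d$ is the topology on $X$ generated by all open balls. For $A\subseteq X$ and $\delta\ll\mathbb{1}$, let $B_R(A,\delta)=\bigcup_{x\in A}B(x,\delta)$. The robust topology $\tau_{d,R}$ on the powerset $\mathsf{P}(X)$ is: $U\in\tau_{d,R}$ iff for every $A\in U$ there is $\delta\ll\mathbb{1}$ with $\mathsf{P}(B_R(A,\delta))\subseteq U$. The open ball topology $\tau_{d_S}$ is defined in the same way using the quantale $\mathsf{C}(Q)$ (with its own way-below relation and unit ${\downarrow}\mathbb{1}$).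 -}

module Defs where

open import Level using (Level; _⊔_; Lift; lift) renaming (suc to lsuc; zero to 0ℓ)
open import Data.Product using (Σ; ∃; _×_; _,_)
open import Data.List using (List; [])
open import Data.List.Relation.Unary.All using (All)
open import Relation.Binary.PropositionalEquality using (_≡_)

record Quantale : Set₁ where
  field
    Carrier : Set
    _⊑_     : Carrier → Carrier → Set
    ⊑-refl  : ∀ {x} → x ⊑ x
    ⊑-trans : ∀ {x y z} → x ⊑ y → y ⊑ z → x ⊑ z
    ⊑-antisym : ∀ {x y} → x ⊑ y → y ⊑ x → x ≡ y
    ⋁       : (Carrier → Set) → Carrier
    ⋁-ub    : ∀ (S : Carrier → Set) x → S x → x ⊑ ⋁ S
    ⋁-least : ∀ (S : Carrier → Set) u → (∀ x → S x → x ⊑ u) → ⋁ S ⊑ u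
    _⊗_     : Carrier → Carrier → Carrier
    𝟙       : Carrier
    ⊗-assoc : ∀ x y z → (x ⊗ y) ⊗ z ≡ x ⊗ (y ⊗ z)
    ⊗-identityˡ : ∀ x → 𝟙 ⊗ x ≡ x
    ⊗-identityʳ : ∀ x → x ⊗ 𝟙 ≡ x
    ⊗-distribˡ : ∀ x (S : Carrier → Set) →
                 x ⊗ ⋁ S ≡ ⋁ (λ z → Σ Carrier λ y → S y × (z ≡ x ⊗ y))
    ⊗-distribʳ : ∀ x (S : Carrier → Set) →
                 ⋁ S ⊗ x ≡ ⋁ (λ z → Σ Carrier λ y → S y × (z ≡ y ⊗ x))

module _ (Q : Quantale) where
  open Quantale Q

  Directed : (Carrier → Set) → Set
  Directed D = (Σ Carrier D) ×
    (∀ a b → D a → D b → Σ Carrier λ c → D c × (a ⊑ c) × (b ⊑ c))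

  _≪_ : Carrier → Carrier → Set₁
  x ≪ y = ∀ (D : Carrier → Set) → Directed D → y ⊑ ⋁ D →
          Σ Carrier λ d → D d × (x ⊑ d)

  -- continuity: y = ⋁ {x : x ≪ y}, i.e. y is the least upper bound of
  -- the elements way below it (the predicate x ≪ y lives in Set₁, so the
  -- join is written out as a least-upper-bound statement)
  IsContinuous : Set₁
  IsContinuous = ∀ y → (∀ x → x ≪ y → x ⊑ y) ×
                       (∀ u → (∀ x → x ≪ y → x ⊑ u) → y ⊑ u)

  ScottClosed : ∀ {ℓ} → (Carrier → Set ℓ) → Set (lsuc 0ℓ ⊔ ℓ)
  ScottClosed C = (∀ x y → x ⊑ y → C y → C x) ×
                  (∀ (D : Carrier → Set) → Directed D → (∀ x → D x → C x) → C (⋁ D))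

  Cl : ∀ ℓc {ℓ} → (Carrier → Set ℓ) → Carrier → Set (lsuc 0ℓ ⊔ lsuc ℓc ⊔ ℓ)
  Cl ℓc S q = ∀ (C : Carrier → Set ℓc) → ScottClosed C → (∀ x → S x → C x) → C q

  -- The quantale C(Q): Scott closed subsets (here: predicates Carrier → Set₁),
  -- ordered by inclusion, with joins of families given by the closure
  -- of the union.

  CQ : Set₂
  CQ = Σ (Carrier → Set₁) ScottClosed

  _⊆Q_ : ∀ {ℓ₁ ℓ₂} → (Carrier → Set ℓ₁) → (Carrier → Set ℓ₂) → Set (ℓ₁ ⊔ ℓ₂)
  A ⊆Q B = ∀ q → A q → B q

  ↓𝟙 : Carrier → Set₁
  ↓𝟙 q = Lift (lsuc 0ℓ) (q ⊑ 𝟙)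

  DirectedC : (I : Set₁) → (I → Carrier → Set₁) → Set₁
  DirectedC I F = I × (∀ i j → Σ I λ k → (F i ⊆Q F k) × (F j ⊆Q F k))

  _≪C_ : (Carrier → Set₁) → (Carrier → Set₁) → Set₂
  Δ ≪C Γ = ∀ (I : Set₁) (F : I → Carrier → Set₁) →
           (∀ i → ScottClosed (F i)) → DirectedC I F →
           Γ ⊆Q Cl (lsuc 0ℓ) (λ q → Σ I λ i → F i q) →
           Σ I λ i → Δ ⊆Q F i

record QMetric (Q : Quantale) (X : Set) : Set where
  open Quantale Q
  field
    d      : X → X → Carrier
    d-tri  : ∀ x y z → (d x y ⊗ d y z) ⊑ d x z
    d-refl : ∀ x → 𝟙 ⊑ d x x

module _ {Q : Quantale} {X : Set} (M : QMetric Q X) where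
  open Quantale Q
  open QMetric M

  P : Set₁
  P = X → Set

  _⊆_ : P → P → Set
  A ⊆ B = ∀ x → A x → B x

  Ball : X → Carrier → X → Set₁
  Ball x δ y = _≪_ Q δ (d x y)

  BR : P → Carrier → X → Set₁
  BR A δ y = Σ X λ x → A x × Ball x δ y

  RobustOpen : ∀ {ℓ} → (P → Set ℓ) → Set (lsuc 0ℓ ⊔ ℓ)
  RobustOpen U = ∀ A → U A →
    Σ Carrier λ δ → _≪_ Q δ 𝟙 × (∀ (A' : P) → (∀ y → A' y → BR A δ y) → U A')

  dS : P → P → Carrier → Set₁
  dS A₁ A₂ q = ∀ x₂ → A₂ x₂ →
    Cl Q 0ℓ (λ z → Σ X λ x₁ → A₁ x₁ × (z ≡ d x₁ x₂)) q

  BallS : P → (Carrier → Set₁) → P → Set₂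
  BallS A Δ A' = _≪C_ Q Δ (dS A A')

  record BallData : Set₂ where
    constructor ball
    field
      center : P
      radius : Carrier → Set₁
      radius-closed : ScottClosed Q radius
      radius-small  : _≪C_ Q radius (↓𝟙 Q)

  InBalls : List BallData → P → Set₂
  InBalls bs A' = All (λ b → BallS (BallData.center b) (BallData.radius b) A') bs

  -- open ball topology τ_{d_S}: the topology generated by the open balls,
  -- i.e. U is open iff every point of U lies in a finite intersection of
  -- open balls contained in U
  BallOpenS : ∀ {ℓ} → (P → Set ℓ) → Set (lsuc (lsuc 0ℓ) ⊔ ℓ)
  BallOpenS U = ∀ A → U A →
    Σ (List BallData) λ bs → InBalls bs A × (∀ A' → InBalls bs A' → U A')

module Submission where

-- Every d_S-ball is robustly open: a radius Δ way below d_S(C, A) in C(Q) lies under finitely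
-- many x with x ≪ q ⊗ δ, q ∈ d_S(C, A), δ ≪ 𝟙, because in a continuous lattice the Scott closure
-- of a down-set S is {q : ⇓q ⊆ S} and every x ≪ q is already way below some q ⊗ δ.  If
-- A' ⊆ B_R(A, δ) then q ⊗ δ ∈ d_S(C, A') by the triangle inequality, so the join of these finitely
-- many δ gives a robust neighbourhood of A inside the ball.  Conversely, for δ ≪ δ' ≪ 𝟙 the
-- d_S-ball of radius ↓δ' around A lies in P(B_R(A, δ)): if ↓δ' ≪ d_S(A, A') then for each y ∈ A'
-- finitely many d(x, y) with x ∈ A already cover δ'.

open import Level using (Lift; lift; lower; _⊔_) renaming (suc to lsuc; zero to 0ℓ)
open import Axiom.ExcludedMiddle using (ExcludedMiddle)
open import Function.Base using (id)
open import Function.Bundles using (_⇔_; mk⇔)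
open import Data.Product using (Σ; _×_; _,_; proj₁; proj₂)
open import Data.Sum using (_⊎_; inj₁; inj₂)
open import Data.Empty using (⊥; ⊥-elim)
open import Data.List using (List; []; _∷_; _++_)
open import Data.List.Relation.Unary.Any as Any using (Any; here; there)
open import Data.List.Relation.Unary.Any.Properties using (¬Any[]; ++⁺ˡ; ++⁺ʳ)
open import Data.List.Relation.Unary.All as All using (All; []; _∷_)
open import Relation.Nullary using (¬_; yes; no)
open import Relation.Nullary.Decidable using (True; toWitness; fromWitness; decidable-stable)
open import Relation.Binary.Bundles using (Preorder)
open import Relation.Binary.PropositionalEquality using (_≡_; refl; sym; cong; subst; isEquivalence)
import Relation.Binary.Reasoning.Preorder as PreorderReasoning
open import Defs hiding (Directed; _≪_; ScottClosed; Cl; DirectedC; _≪C_; _⊆Q_)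

module QuantaleBasics (Q : Quantale) where
  open Quantale Q

  Directed : (Carrier → Set) → Set
  Directed = Defs.Directed Q

  infix 4 _≪_ _≪C_ _⊆Q_
  infixr 25 _∨_

  _≪_ : Carrier → Carrier → Set₁
  _≪_ = Defs._≪_ Q

  _⊆Q_ : ∀ {a b} → (Carrier → Set a) → (Carrier → Set b) → Set (a ⊔ b)
  _⊆Q_ = Defs._⊆Q_ Q

  ScottClosed : ∀ {ℓ} → (Carrier → Set ℓ) → Set (lsuc 0ℓ ⊔ ℓ)
  ScottClosed = Defs.ScottClosed Q

  Cl : ∀ ℓc {ℓ} → (Carrier → Set ℓ) → Carrier → Set (lsuc 0ℓ ⊔ lsuc ℓc ⊔ ℓ)
  Cl = Defs.Cl Q

  DirectedC : (I : Set₁) → (I → Carrier → Set₁) → Set₁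
  DirectedC = Defs.DirectedC Q

  _≪C_ : (Carrier → Set₁) → (Carrier → Set₁) → Set₂
  _≪C_ = Defs._≪C_ Q

  DownClosed : ∀ {ℓ} → (Carrier → Set ℓ) → Set ℓ
  DownClosed C = ∀ x y → x ⊑ y → C y → C x

  ⊑-reflexive : ∀ {x y} → x ≡ y → x ⊑ y
  ⊑-reflexive refl = ⊑-refl

  ⊑-preorder : Preorder _ _ _
  ⊑-preorder = record
    { Carrier = Carrier ; _≈_ = _≡_ ; _≲_ = _⊑_
    ; isPreorder = record { isEquivalence = isEquivalence ; reflexive = ⊑-reflexive ; trans = ⊑-trans } }

  module ⊑-Reasoning = PreorderReasoning ⊑-preorder

  ⋁-mono : ∀ {S T : Carrier → Set} → S ⊆Q T → ⋁ S ⊑ ⋁ T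
  ⋁-mono S⊆T = ⋁-least _ _ λ x Sx → ⋁-ub _ x (S⊆T x Sx)

  ↓_ : Carrier → Carrier → Set
  (↓ y) x = x ⊑ y

  ⋁-↓ : ∀ y → ⋁ (↓ y) ≡ y
  ⋁-↓ y = ⊑-antisym (⋁-least _ y λ _ x⊑y → x⊑y) (⋁-ub _ y ⊑-refl)

  ⊥Q : Carrier
  ⊥Q = ⋁ (λ _ → ⊥)

  ⊥Q-least : ∀ x → ⊥Q ⊑ x
  ⊥Q-least x = ⋁-least _ x λ _ ()

  _∨_ : Carrier → Carrier → Carrier
  a ∨ b = ⋁ (λ z → z ≡ a ⊎ z ≡ b)

  x⊑x∨y : ∀ x y → x ⊑ x ∨ y
  x⊑x∨y x y = ⋁-ub _ x (inj₁ refl)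

  y⊑x∨y : ∀ x y → y ⊑ x ∨ y
  y⊑x∨y x y = ⋁-ub _ y (inj₂ refl)

  ∨-least : ∀ {x y z} → x ⊑ z → y ⊑ z → x ∨ y ⊑ z
  ∨-least x⊑z y⊑z = ⋁-least _ _ λ { _ (inj₁ refl) → x⊑z ; _ (inj₂ refl) → y⊑z }

  Image : (Carrier → Carrier) → (Carrier → Set) → Carrier → Set
  Image f D z = Σ Carrier λ y → D y × (z ≡ f y)

  Image-directed : ∀ {f D} → (∀ {a b} → a ⊑ b → f a ⊑ f b) → Directed D → Directed (Image f D)
  Image-directed {f} f-mono ((d , Dd) , upper) =
    (f d , d , Dd , refl) , λ { _ _ (a , Da , refl) (b , Db , refl) →
      let (c , Dc , a⊑c , b⊑c) = upper a b Da Db in f c , (c , Dc , refl) , f-mono a⊑c , f-mono b⊑c }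

  ⊗-monoˡ-⊑ : ∀ c {a b} → a ⊑ b → (a ⊗ c) ⊑ (b ⊗ c)
  ⊗-monoˡ-⊑ c {a} {b} a⊑b = begin
    a ⊗ c                    ≲⟨ ⋁-ub _ _ (a , a⊑b , refl) ⟩
    ⋁ (Image (_⊗ c) (↓ b))   ≡⟨ sym (⊗-distribʳ c (↓ b)) ⟩
    ⋁ (↓ b) ⊗ c              ≡⟨ cong (_⊗ c) (⋁-↓ b) ⟩
    b ⊗ c                    ∎
    where open ⊑-Reasoning

  ⊗-monoʳ-⊑ : ∀ c {a b} → a ⊑ b → (c ⊗ a) ⊑ (c ⊗ b)
  ⊗-monoʳ-⊑ c {a} {b} a⊑b = begin
    c ⊗ a                    ≲⟨ ⋁-ub _ _ (a , a⊑b , refl) ⟩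
    ⋁ (Image (c ⊗_) (↓ b))   ≡⟨ sym (⊗-distribˡ c (↓ b)) ⟩
    c ⊗ ⋁ (↓ b)              ≡⟨ cong (c ⊗_) (⋁-↓ b) ⟩
    c ⊗ b                    ∎
    where open ⊑-Reasoning

  ↓-directed : ∀ y → Directed (↓ y)
  ↓-directed y = (y , ⊑-refl) , λ _ _ a⊑y b⊑y → y , ⊑-refl , a⊑y , b⊑y

  ≪⇒⊑ : ∀ {x y} → x ≪ y → x ⊑ y
  ≪⇒⊑ {y = y} x≪y =
    let (d , d⊑y , x⊑d) = x≪y (↓ y) (↓-directed y) (⋁-ub _ y ⊑-refl) in ⊑-trans x⊑d d⊑y

  ≪-⊑-trans : ∀ {x y z} → x ≪ y → y ⊑ z → x ≪ z
  ≪-⊑-trans x≪y y⊑z D D-dir z⊑⋁D = x≪y D D-dir (⊑-trans y⊑z z⊑⋁D)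

  ⊑-≪-trans : ∀ {x y z} → x ⊑ y → y ≪ z → x ≪ z
  ⊑-≪-trans x⊑y y≪z D D-dir z⊑⋁D =
    let (d , Dd , y⊑d) = y≪z D D-dir z⊑⋁D in d , Dd , ⊑-trans x⊑y y⊑d

  ⊥Q-≪ : ∀ x → ⊥Q ≪ x
  ⊥Q-≪ x D ((d , Dd) , _) _ = d , Dd , ⊥Q-least d

  ∨-≪ : ∀ {x y z} → x ≪ z → y ≪ z → x ∨ y ≪ z
  ∨-≪ x≪z y≪z D D-dir@(_ , upper) z⊑⋁D =
    let (d₁ , D₁ , x⊑d₁) = x≪z D D-dir z⊑⋁D
        (d₂ , D₂ , y⊑d₂) = y≪z D D-dir z⊑⋁D
        (d , Dd , d₁⊑d , d₂⊑d) = upper d₁ d₂ D₁ D₂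
    in d , Dd , ∨-least (⊑-trans x⊑d₁ d₁⊑d) (⊑-trans y⊑d₂ d₂⊑d)

  ↓-closed : ∀ {y} → ScottClosed (↓ y)
  ↓-closed = (λ _ _ a⊑b b⊑y → ⊑-trans a⊑b b⊑y) , λ D _ D⊆↓y → ⋁-least D _ D⊆↓y

  ScottClosed-resp : ∀ {a b} {A : Carrier → Set a} {B : Carrier → Set b} →
                     A ⊆Q B → B ⊆Q A → ScottClosed A → ScottClosed B
  ScottClosed-resp A⊆B B⊆A (A-down , A-⋁) =
    (λ x y x⊑y By → A⊆B x (A-down x y x⊑y (B⊆A y By))) ,
    λ D D-dir D⊆B → A⊆B _ (A-⋁ D D-dir λ x Dx → B⊆A x (D⊆B x Dx))

  ⊗ʳ-preimage-closed : ∀ {ℓ} {C : Carrier → Set ℓ} δ → ScottClosed C → ScottClosed (λ p → C (p ⊗ δ))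
  ⊗ʳ-preimage-closed {C = C} δ (C-down , C-⋁) =
    (λ a b a⊑b → C-down _ _ (⊗-monoˡ-⊑ δ a⊑b)) ,
    λ D D-dir D⊆C → subst C (sym (⊗-distribʳ δ D))
      (C-⋁ (Image (_⊗ δ) D) (Image-directed (⊗-monoˡ-⊑ δ) D-dir) λ { _ (y , Dy , refl) → D⊆C y Dy })

  Cl-mono : ∀ {ℓc a b} {S : Carrier → Set a} {T : Carrier → Set b} → S ⊆Q T → Cl ℓc S ⊆Q Cl ℓc T
  Cl-mono S⊆T q q∈ClS K K-closed T⊆K = q∈ClS K K-closed λ x Sx → T⊆K x (S⊆T x Sx)

  Cl-⊗ʳ : ∀ {ℓc a b} {S : Carrier → Set a} {T : Carrier → Set b} {q δ} →
          (∀ s → S s → Σ Carrier λ t → T t × (s ⊗ δ) ⊑ t) → Cl ℓc S q → Cl ℓc T (q ⊗ δ)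
  Cl-⊗ʳ {δ = δ} S⊗δ⊑T q∈ClS K K-closed T⊆K =
    q∈ClS _ (⊗ʳ-preimage-closed δ K-closed) λ s Ss →
      let (t , Tt , s⊗δ⊑t) = S⊗δ⊑T s Ss in proj₁ K-closed _ t s⊗δ⊑t (T⊆K t Tt)

  FinDown : ∀ {e} {E : Set e} → (E → Carrier) → List E → Carrier → Set e
  FinDown f l q = Any (λ e → q ⊑ f e) l

  FinDown-⊆ : ∀ {e ℓ} {E : Set e} {f : E → Carrier} {l} {C : Carrier → Set ℓ} →
              DownClosed C → All (λ e → C (f e)) l → FinDown f l ⊆Q C
  FinDown-⊆ C-down (C-fe ∷ _) q (here q⊑fe) = C-down _ _ q⊑fe C-fe
  FinDown-⊆ C-down (_ ∷ C-gens) q (there q∈) = FinDown-⊆ C-down C-gens q q∈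

  DirectedC-All : ∀ {e} {E : Set e} {f : E → Carrier} {I F} → DirectedC I F → ∀ {l} →
                  All (λ e → Σ I λ i → F i (f e)) l → Σ I λ i → All (λ e → F i (f e)) l
  DirectedC-All (i₀ , _) [] = i₀ , []
  DirectedC-All F-dir@(_ , upper) ((i , fe∈Fi) ∷ rest) =
    let (j , rest∈Fj) = DirectedC-All F-dir rest
        (k , Fi⊆Fk , Fj⊆Fk) = upper i j
    in k , Fi⊆Fk _ fe∈Fi ∷ All.map (Fj⊆Fk _) rest∈Fj

module ScottClosedSets (lem : ∀ {ℓ} → ExcludedMiddle ℓ) (Q : Quantale) where
  open Quantale Q
  open QuantaleBasics Q

  -- With excluded middle every proposition is equivalent to one in Set.
  Small : ∀ {a} → Set a → Set
  Small A = True (lem {P = A})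

  resize : ∀ {a} {A : Set a} → A → Small A
  resize = fromWitness

  unresize : ∀ {a} {A : Set a} → Small A → A
  unresize = toWitness

  ∪-closed : ∀ {a b} {A : Carrier → Set a} {B : Carrier → Set b} →
             ScottClosed A → ScottClosed B → ScottClosed (λ q → A q ⊎ B q)
  ∪-closed {A = A} {B} (A-down , A-⋁) (B-down , B-⋁) = down , ⋁-closed
    where
      down : DownClosed (λ q → A q ⊎ B q)
      down x y x⊑y (inj₁ Ay) = inj₁ (A-down x y x⊑y Ay)
      down x y x⊑y (inj₂ By) = inj₂ (B-down x y x⊑y By)

      -- Once one member d₀ of D is outside A, every common upper bound with d₀ is in B.
      ⋁-closed : ∀ D → Directed D → (∀ x → D x → A x ⊎ B x) → A (⋁ D) ⊎ B (⋁ D)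
      ⋁-closed D D-dir@(_ , upper) D⊆A∪B with lem {P = Σ Carrier λ d → D d × ¬ A d}
      ... | yes (d₀ , Dd₀ , d₀∉A) = inj₂ (B-⋁ D D-dir D⊆B)
        where
          D⊆B : ∀ d → D d → B d
          D⊆B d Dd with upper d₀ d Dd₀ Dd
          ... | c , Dc , d₀⊑c , d⊑c with D⊆A∪B c Dc
          ... | inj₁ Ac = ⊥-elim (d₀∉A (A-down d₀ c d₀⊑c Ac))
          ... | inj₂ Bc = B-down d c d⊑c Bc
      ... | no ∄d∉A = inj₁ (A-⋁ D D-dir λ d Dd → decidable-stable lem λ d∉A → ∄d∉A (d , Dd , d∉A))

  FinDown-closed : ∀ {e} {E : Set e} (f : E → Carrier) l → ScottClosed (FinDown f l)
  FinDown-closed f [] = (λ _ _ _ ()) , λ { D ((d , Dd) , _) D⊆∅ → ⊥-elim (¬Any[] (D⊆∅ d Dd)) }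
  FinDown-closed f (e ∷ l) =
    ScottClosed-resp (λ _ → Any.fromSum) (λ _ → Any.toSum) (∪-closed ↓-closed (FinDown-closed f l))

  Cl-resize : ∀ {ℓ} {S : Carrier → Set ℓ} → Cl 0ℓ S ⊆Q Cl (lsuc 0ℓ) S
  Cl-resize q q∈ClS K K-closed S⊆K =
    unresize (q∈ClS (λ p → Small (K p))
                    (ScottClosed-resp (λ _ → resize) (λ _ → unresize) K-closed)
                    (λ x Sx → resize (S⊆K x Sx)))

  ≪C-finite : ∀ {Δ Γ : Carrier → Set₁} (S : Carrier → Set₁) → Δ ≪C Γ → Γ ⊆Q Cl (lsuc 0ℓ) S →
              Σ (List (Σ Carrier S)) λ l → Δ ⊆Q FinDown proj₁ l
  ≪C-finite S Δ≪Γ Γ⊆ClS =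
    Δ≪Γ (List (Σ Carrier S)) (FinDown proj₁) (FinDown-closed proj₁) directed
        λ q Γq → Cl-mono S⊆⋃ q (Γ⊆ClS q Γq)
    where
      directed : DirectedC (List (Σ Carrier S)) (FinDown proj₁)
      directed = [] , λ l m → l ++ m , (λ _ → ++⁺ˡ) , (λ _ → ++⁺ʳ l)

      S⊆⋃ : S ⊆Q (λ q → Σ (List (Σ Carrier S)) λ l → FinDown proj₁ l q)
      S⊆⋃ q Sq = (q , Sq) ∷ [] , here ⊑-refl

module ContinuousQuantale (lem : ∀ {ℓ} → ExcludedMiddle ℓ) (Q : Quantale) (cont : IsContinuous Q) where
  open Quantale Q
  open QuantaleBasics Q
  open ScottClosedSets lem Q

  ⇓_ : Carrier → Carrier → Set
  (⇓ y) x = Small (x ≪ y)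

  ⇓-directed : ∀ {y} → Directed (⇓ y)
  ⇓-directed = (⊥Q , resize (⊥Q-≪ _)) , λ a b a≪ b≪ →
    a ∨ b , resize (∨-≪ (unresize a≪) (unresize b≪)) , x⊑x∨y a b , y⊑x∨y a b

  ⊑-⋁⇓ : ∀ {y} → y ⊑ ⋁ (⇓ y)
  ⊑-⋁⇓ {y} = proj₂ (cont y) _ λ x x≪y → ⋁-ub _ x (resize x≪y)

  Approximants : (Carrier → Set) → Carrier → Set
  Approximants D x = Σ Carrier λ d → D d × (⇓ d) x

  Approximants-directed : ∀ {D} → Directed D → Directed (Approximants D)
  Approximants-directed ((d₀ , Dd₀) , upper) =
    (⊥Q , d₀ , Dd₀ , resize (⊥Q-≪ d₀)) , λ { a b (d₁ , D₁ , a≪d₁) (d₂ , D₂ , b≪d₂) →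
      let (d , Dd , d₁⊑d , d₂⊑d) = upper d₁ d₂ D₁ D₂
          a∨b≪d = ∨-≪ (≪-⊑-trans (unresize a≪d₁) d₁⊑d) (≪-⊑-trans (unresize b≪d₂) d₂⊑d)
      in a ∨ b , (d , Dd , resize a∨b≪d) , x⊑x∨y a b , y⊑x∨y a b }

  ⋁-⊑-⋁Approximants : ∀ D → ⋁ D ⊑ ⋁ (Approximants D)
  ⋁-⊑-⋁Approximants D =
    ⋁-least D _ λ d Dd → ⊑-trans ⊑-⋁⇓ (⋁-mono λ x x≪d → d , Dd , x≪d)

  ≪-directed : ∀ {D x y} → Directed D → x ≪ y → y ⊑ ⋁ D → Σ Carrier λ d → D d × x ≪ d
  ≪-directed {D} D-dir x≪y y⊑⋁D =
    let (w , (d , Dd , w≪d) , x⊑w) =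
          x≪y (Approximants D) (Approximants-directed D-dir) (⊑-trans y⊑⋁D (⋁-⊑-⋁Approximants D))
    in d , Dd , ⊑-≪-trans x⊑w (unresize w≪d)

  ≪-interpolate : ∀ {x y} → x ≪ y → Σ Carrier λ z → x ≪ z × z ≪ y
  ≪-interpolate x≪y =
    let (z , z≪y , x≪z) = ≪-directed ⇓-directed x≪y ⊑-⋁⇓ in z , x≪z , unresize z≪y

  ⊑-⋁⊗⇓𝟙 : ∀ q → q ⊑ ⋁ (Image (q ⊗_) (⇓ 𝟙))
  ⊑-⋁⊗⇓𝟙 q = begin
    q             ≡⟨ sym (⊗-identityʳ q) ⟩
    q ⊗ 𝟙         ≲⟨ ⊗-monoʳ-⊑ q ⊑-⋁⇓ ⟩
    q ⊗ ⋁ (⇓ 𝟙)   ≡⟨ ⊗-distribˡ q (⇓ 𝟙) ⟩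
    ⋁ (Image (q ⊗_) (⇓ 𝟙)) ∎
    where open ⊑-Reasoning

  ≪-⊗⇓𝟙 : ∀ {x q} → x ≪ q → Σ Carrier λ δ → δ ≪ 𝟙 × x ≪ q ⊗ δ
  ≪-⊗⇓𝟙 {q = q} x≪q with ≪-directed (Image-directed (⊗-monoʳ-⊑ q) ⇓-directed) x≪q (⊑-⋁⊗⇓𝟙 q)
  ... | _ , (δ , δ≪𝟙 , refl) , x≪q⊗δ = δ , unresize δ≪𝟙 , x≪q⊗δ

  -- These two lemmas say that the Scott closure of a down-set S is {q : ⇓q ⊆ S}.
  ⇓⊆⇒∈Cl : ∀ {ℓc ℓ} {S : Carrier → Set ℓ} {q} → (∀ x → x ≪ q → S x) → Cl ℓc S q
  ⇓⊆⇒∈Cl ⇓q⊆S K (K-down , K-⋁) S⊆K =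
    K-down _ _ ⊑-⋁⇓ (K-⋁ _ ⇓-directed λ x x≪q → S⊆K x (⇓q⊆S x (unresize x≪q)))

  ∈Cl⇒⇓⊆ : ∀ {S : Carrier → Set₁} {q x} → DownClosed S → Cl (lsuc 0ℓ) S q → x ≪ q → S x
  ∈Cl⇒⇓⊆ {S} S-down q∈ClS = q∈ClS K (K-down , K-⋁) S⊆K _
    where
      K : Carrier → Set₁
      K q = ∀ x → x ≪ q → S x

      K-down : DownClosed K
      K-down a b a⊑b Kb x x≪a = Kb x (≪-⊑-trans x≪a a⊑b)

      K-⋁ : ∀ D → Directed D → (∀ d → D d → K d) → K (⋁ D)
      K-⋁ D D-dir D⊆K x x≪⋁D =
        let (d , Dd , x≪d) = ≪-directed D-dir x≪⋁D ⊑-refl in D⊆K d Dd x x≪d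

      S⊆K : S ⊆Q K
      S⊆K q Sq x x≪q = S-down x q (≪⇒⊑ x≪q) Sq

  FinDown-≪C : ∀ {e} {E : Set e} {f : E → Carrier} {l} {Δ Γ : Carrier → Set₁} →
               Δ ⊆Q FinDown f l → All (λ e → Σ Carrier λ γ → Γ γ × f e ≪ γ) l → Δ ≪C Γ
  FinDown-≪C {f = f} {Γ = Γ} Δ⊆ gens≪Γ I F F-closed F-dir Γ⊆Cl⋃F =
    let (i , gens∈Fi) = DirectedC-All F-dir (All.map in-some-F gens≪Γ)
    in i , λ q Δq → FinDown-⊆ (proj₁ (F-closed i)) gens∈Fi q (Δ⊆ q Δq)
    where
      ⋃F-down : DownClosed (λ q → Σ I λ i → F i q)
      ⋃F-down a b a⊑b (i , Fib) = i , proj₁ (F-closed i) a b a⊑b Fib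

      in-some-F : ∀ {e} → Σ Carrier (λ γ → Γ γ × f e ≪ γ) → Σ I λ i → F i (f e)
      in-some-F (γ , Γγ , fe≪γ) = ∈Cl⇒⇓⊆ ⋃F-down (Γ⊆Cl⋃F γ Γγ) fe≪γ

  ↓₁ : Carrier → Carrier → Set₁
  ↓₁ y x = Lift (lsuc 0ℓ) (x ⊑ y)

  ↓₁-closed : ∀ {y} → ScottClosed (↓₁ y)
  ↓₁-closed = ScottClosed-resp (λ _ → lift) (λ _ → lower) ↓-closed

  ↓₁-≪C : ∀ {Γ : Carrier → Set₁} {γ δ} → Γ γ → δ ≪ γ → ↓₁ δ ≪C Γ
  ↓₁-≪C {δ = δ} Γγ δ≪γ =
    FinDown-≪C {f = id} {l = δ ∷ []} (λ _ x⊑δ → here (lower x⊑δ)) ((_ , Γγ , δ≪γ) ∷ [])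

module HausdorffMetric (lem : ∀ {ℓ} → ExcludedMiddle ℓ) (Q : Quantale) (cont : IsContinuous Q)
                       {X : Set} (M : QMetric Q X) where
  open Quantale Q
  open QuantaleBasics Q
  open ScottClosedSets lem Q
  open ContinuousQuantale lem Q cont
  open QMetric M

  BR-antitone : ∀ {A δ δ' y} → δ ⊑ δ' → BR M A δ' y → BR M A δ y
  BR-antitone δ⊑δ' (x , Ax , δ'≪dxy) = x , Ax , ⊑-≪-trans δ⊑δ' δ'≪dxy

  RobustNbhd : ∀ {ℓ} → P M → (P M → Set ℓ) → Set (lsuc 0ℓ ⊔ ℓ)
  RobustNbhd A V = Σ Carrier λ δ → δ ≪ 𝟙 × (∀ A' → (∀ y → A' y → BR M A δ y) → V A')

  RobustNbhd-map : ∀ {ℓ ℓ'} {A} {V : P M → Set ℓ} {W : P M → Set ℓ'} →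
                   (∀ A' → V A' → W A') → RobustNbhd A V → RobustNbhd A W
  RobustNbhd-map V⊆W (δ , δ≪𝟙 , nbhd⊆V) = δ , δ≪𝟙 , λ A' A'⊆ → V⊆W A' (nbhd⊆V A' A'⊆)

  RobustNbhd-All : ∀ {a ℓ} {I : Set a} {V : I → P M → Set ℓ} {A} {l : List I} →
                   All (λ i → RobustNbhd A (V i)) l → RobustNbhd A (λ A' → All (λ i → V i A') l)
  RobustNbhd-All [] = ⊥Q , ⊥Q-≪ 𝟙 , λ _ _ → []
  RobustNbhd-All ((δ , δ≪𝟙 , nbhd⊆V) ∷ rest) =
    let (δ' , δ'≪𝟙 , nbhd⊆rest) = RobustNbhd-All rest
    in δ ∨ δ' , ∨-≪ δ≪𝟙 δ'≪𝟙 , λ A' A'⊆ →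
         nbhd⊆V A' (λ y A'y → BR-antitone (x⊑x∨y δ δ') (A'⊆ y A'y)) ∷
         nbhd⊆rest A' (λ y A'y → BR-antitone (y⊑x∨y δ δ') (A'⊆ y A'y))

  dS-refl : ∀ A → dS M A A 𝟙
  dS-refl A x Ax K (K-down , _) S⊆K = K-down 𝟙 (d x x) (d-refl x) (S⊆K _ (x , Ax , refl))

  dS-shift : ∀ {C A A' q δ} → dS M C A q → (∀ y → A' y → BR M A δ y) → dS M C A' (q ⊗ δ)
  dS-shift q∈dS A'⊆ y A'y =
    let (x , Ax , δ≪dxy) = A'⊆ y A'y
    in Cl-⊗ʳ (λ { _ (x₁ , Cx₁ , refl) →
                 d x₁ y , (x₁ , Cx₁ , refl) , ⊑-trans (⊗-monoʳ-⊑ _ (≪⇒⊑ δ≪dxy)) (d-tri x₁ x y) })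
             (q∈dS x Ax)

  BallS-robust : ∀ {C A} {Δ : Carrier → Set₁} → Δ ≪C dS M C A → RobustNbhd A (λ A' → Δ ≪C dS M C A')
  BallS-robust {C} {A} Δ≪dS =
    let (l , Δ⊆) = ≪C-finite Generator Δ≪dS dS⊆ClGenerator
    in RobustNbhd-map (λ _ → FinDown-≪C Δ⊆) (RobustNbhd-All (All.universal shifted-nbhd l))
    where
      Generator : Carrier → Set₁
      Generator x = Σ Carrier λ δ → δ ≪ 𝟙 × Σ Carrier λ q → dS M C A q × x ≪ q ⊗ δ

      dS⊆ClGenerator : dS M C A ⊆Q Cl (lsuc 0ℓ) Generator
      dS⊆ClGenerator q q∈dS = ⇓⊆⇒∈Cl λ x x≪q →
        let (δ , δ≪𝟙 , x≪q⊗δ) = ≪-⊗⇓𝟙 x≪q in δ , δ≪𝟙 , q , q∈dS , x≪q⊗δ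

      shifted-nbhd : (g : Σ Carrier Generator) →
                     RobustNbhd A (λ A' → Σ Carrier λ γ → dS M C A' γ × proj₁ g ≪ γ)
      shifted-nbhd (x , δ , δ≪𝟙 , q , q∈dS , x≪q⊗δ) =
        δ , δ≪𝟙 , λ A' A'⊆ → q ⊗ δ , dS-shift q∈dS A'⊆ , x≪q⊗δ

  ↓₁-≪C-dS⇒⊆BR : ∀ {A A' δ δ'} → δ ≪ δ' → ↓₁ δ' ≪C dS M A A' → ∀ y → A' y → BR M A δ y
  ↓₁-≪C-dS⇒⊆BR {A} {A'} δ≪δ' ↓δ'≪dS y A'y =
    let (l , ↓δ'⊆) = ≪C-finite Distances ↓δ'≪dS λ q q∈dS → Cl-mono (λ _ → lift) q (Cl-resize q (q∈dS y A'y))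
        ((z , lift (x , Ax , z≡dxy)) , δ'⊑z) = Any.satisfied (↓δ'⊆ _ (lift ⊑-refl))
    in x , Ax , ≪-⊑-trans δ≪δ' (⊑-trans δ'⊑z (⊑-reflexive z≡dxy))
    where
      Distances : Carrier → Set₁
      Distances z = Lift (lsuc 0ℓ) (Σ X λ x → A x × (z ≡ d x y))

  ballOpen⇒robustOpen : ∀ {ℓ} (U : P M → Set ℓ) → BallOpenS M U → RobustOpen M U
  ballOpen⇒robustOpen U U-open A A∈U =
    let (bs , A∈bs , bs⊆U) = U-open A A∈U
    in RobustNbhd-map bs⊆U (RobustNbhd-All (All.map BallS-robust A∈bs))

  robustOpen⇒ballOpen : ∀ {ℓ} (U : P M → Set ℓ) → RobustOpen M U → BallOpenS M U
  robustOpen⇒ballOpen U U-robust A A∈U =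
    let (δ , δ≪𝟙 , nbhd⊆U) = U-robust A A∈U
        (δ' , δ≪δ' , δ'≪𝟙) = ≪-interpolate δ≪𝟙
    in ball A (↓₁ δ') ↓₁-closed (↓₁-≪C (lift ⊑-refl) δ'≪𝟙) ∷ [] ,
       ↓₁-≪C (dS-refl A) δ'≪𝟙 ∷ [] ,
       λ { A' (A'∈ball ∷ []) → nbhd⊆U A' (↓₁-≪C-dS⇒⊆BR δ≪δ' A'∈ball) }

theorem66 : (lem : ∀ {ℓ} → ExcludedMiddle ℓ) →
            (Q : Quantale) → IsContinuous Q →
            {X : Set} (M : QMetric Q X) →
            ∀ {ℓ} (U : P M → Set ℓ) → RobustOpen M U ⇔ BallOpenS M U
theorem66 lem Q cont M U = mk⇔ (robustOpen⇒ballOpen U) (ballOpen⇒robustOpen U)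
  where open HausdorffMetric lem Q cont M
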